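{- Let $X$ be a finite set of alternatives with $|X|=m\geq 2$ and $N=\{1,\dots,n\}$ with $n\geq 2$ a set of individuals. Let $G$ be a social choice correspondence on $L(X)^N$ that is non-constant (i.e. there exist profiles $u,u^*$ with $G(u)\neq G(u^*)$) and that has an ineffective individual. Then $G$ is unbalanced (i.e. it does not satisfy balancedness).
   Context: An ordering on $X$ is a complete, asymmetric, transitive relation on $X$ (a strict linear order); $L(X)$ is the set of all orderings. A profile is an element $u=(u(1),\dots,u(n))\in L(X)^N$. A social choice correspondence is a map $G$ from $L(X)^N$ to the non-empty subsets of $X$. Profile $v$ is constructed from profile $u$ by transposition pair $(x,y)$ via individuals $i$ and $j$ if at $u$, $x$ is immediately above $y$ in $u(i)$ and $y$ is immediately above $x$ in $u(j)$, and $v$ is identical to $u$ except that in the orderings of $i$ and $j$ the alternatives $x$ and $y$ are swapped. $G$ is balanced (satisfies balancedness) if for all $x,y,u,v,i,j$, whenever $v$ is constructed from $u$ by transposition pair $(x,y)$ via individuals $i$ and $j$, then $G(v)=G(u)$; otherwise $G$ is unbalanced. An individual $i$ is ineffective for $G$ if for all profiles $u,u^*$ with $u(j)=u^*(j)$ for all $j\neq i$, we have $G(u)=G(u^*)$. -}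

module Defs where

open import Data.Nat using (ℕ)
open import Data.Bool using (Bool; T)
open import Data.Fin using (Fin; _≟_)
open import Data.Fin.Subset using (Subset; Nonempty)
open import Data.Vec using (Vec; lookup; tabulate)
open import Data.Product using (_×_; ∃; ∃-syntax; Σ-syntax)
open import Data.Sum using (_⊎_)
open import Relation.Nullary using (¬_; yes; no)
open import Relation.Binary.PropositionalEquality using (_≡_; _≢_)

-- X = Fin m (alternatives), N = Fin n (individuals).

-- The property fields are irrelevant,
-- so two orderings are equal exactly when their relations are equal.
record Ordering (m : ℕ) : Set where
  field
    rel : Vec (Vec Bool m) m
  above : Fin m → Fin m → Set
  above x y = T (lookup (lookup rel x) y)
  field
    .asym     : ∀ x y → above x y → ¬ above y x
    .trans    : ∀ x y z → above x y → above y z → above x z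
    .complete : ∀ x y → x ≢ y → above x y ⊎ above y x

open Ordering public

_≻[_]_ : {m : ℕ} → Fin m → Ordering m → Fin m → Set
x ≻[ o ] y = above o x y

ImmAbove : {m : ℕ} → Ordering m → Fin m → Fin m → Set
ImmAbove {m} o x y = (x ≻[ o ] y) × (∀ (z : Fin m) → ¬ ((x ≻[ o ] z) × (z ≻[ o ] y)))

Profile : ℕ → ℕ → Set
Profile m n = Vec (Ordering m) n

swapFin : {m : ℕ} → Fin m → Fin m → Fin m → Fin m
swapFin x y a with a ≟ x
... | yes _ = y
... | no _ with a ≟ y
...   | yes _ = x
...   | no _ = a

swapRel : {m : ℕ} → Fin m → Fin m → Vec (Vec Bool m) m → Vec (Vec Bool m) m
swapRel x y M = tabulate λ a → tabulate λ b → lookup (lookup M (swapFin x y a)) (swapFin x y b)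

TranspPair : {m n : ℕ} → Profile m n → Profile m n → Fin m → Fin m → Fin n → Fin n → Set
TranspPair {m} {n} u v x y i j =
  ImmAbove (lookup u i) x y × ImmAbove (lookup u j) y x
  × rel (lookup v i) ≡ swapRel x y (rel (lookup u i))
  × rel (lookup v j) ≡ swapRel x y (rel (lookup u j))
  × (∀ (k : Fin n) → k ≢ i → k ≢ j → lookup v k ≡ lookup u k)

-- A social choice correspondence is G : Profile m n → Subset m with
-- non-empty values (imposed as a separate hypothesis).
SCC : ℕ → ℕ → Set
SCC m n = Profile m n → Subset m

Balanced : {m n : ℕ} → SCC m n → Set
Balanced {m} {n} G = ∀ (x y : Fin m) (u v : Profile m n) (i j : Fin n) →
  TranspPair u v x y i j → G v ≡ G u

Ineffective : {m n : ℕ} → SCC m n → Fin n → Set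
Ineffective {m} {n} G i = ∀ (u u* : Profile m n) →
  (∀ (j : Fin n) → j ≢ i → lookup u j ≡ lookup u* j) → G u ≡ G u*

NonConstant : {m n : ℕ} → SCC m n → Set
NonConstant {m} {n} G = ∃[ u ] ∃[ u* ] (G u ≢ G u*)

-- If i is ineffective, any other individual j can transpose an adjacent pair x ≻ y of its
-- ordering without changing G: first give i the ordering with x and y swapped (free, as i is
-- ineffective), then apply the transposition pair (x, y) via j and i (free by balancedness),
-- and finally restore i. Adjacent transpositions connect any two orderings (bubble sort), so
-- G is invariant under changing any single ordering, hence constant. The bounds on m and n
-- and the non-emptiness of the values of G are not needed.
module Submission where

open import Defs hiding (trans)
open import Algebra.Properties.Monoid.Sum using (sum)
open import Data.Bool using (Bool; true; false; T; _∧_; _xor_; if_then_else_)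
open import Data.Bool.Properties using (T-∧)
open import Data.Empty using (⊥-elim)
import Data.Empty.Irrelevant as Irrelevant
open import Data.Fin using (Fin; zero; suc; _≟_)
open import Data.Fin.Properties using (any?)
open import Data.Fin.Subset using (Nonempty)
open import Data.Nat using (ℕ; zero; suc; _≤_; _<_; z≤n; s≤s)
open import Data.Nat.Induction using (<-wellFounded)
open import Data.Nat.Properties using (+-0-monoid; ≤-refl; +-mono-≤; +-mono-<-≤; +-mono-≤-<)
open import Data.Product using (_×_; _,_; proj₁; proj₂; ∃-syntax)
open import Data.Sum using (_⊎_; inj₁; inj₂; map)
open import Data.Unit using (tt)
open import Data.Vec using (Vec; _∷_; []; lookup; _[_]≔_)
open import Data.Vec.Properties
  using (lookup∘tabulate; tabulate∘lookup; tabulate-cong; lookup∘update; lookup∘update′;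
         []≔-idempotent; []≔-lookup)
open import Function using (_∘_; Equivalence)
open import Induction.WellFounded using (Acc; acc)
open import Relation.Binary.Construct.Closure.ReflexiveTransitive using (Star; ε; _◅_)
open import Relation.Binary.PropositionalEquality
  using (_≡_; _≢_; refl; sym; trans; cong; subst; subst₂; module ≡-Reasoning)
open import Relation.Nullary using (¬_; yes; no)
open import Relation.Nullary.Decidable using (T?; ¬?; _×-dec_; _⊎-dec_; recompute; decidable-stable)

private
  variable
    m n : ℕ

∑ : (Fin n → ℕ) → ℕ
∑ = sum +-0-monoid

∑-mono-≤ : {f g : Fin n → ℕ} → (∀ a → f a ≤ g a) → ∑ f ≤ ∑ g
∑-mono-≤ {zero}  f≤g = z≤n
∑-mono-≤ {suc n} f≤g = +-mono-≤ (f≤g zero) (∑-mono-≤ (f≤g ∘ suc))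

∑-mono-< : {f g : Fin n → ℕ} → (∀ a → f a ≤ g a) → ∀ c → f c < g c → ∑ f < ∑ g
∑-mono-< {suc n} f≤g zero    fc<gc = +-mono-<-≤ fc<gc (∑-mono-≤ (f≤g ∘ suc))
∑-mono-< {suc n} f≤g (suc c) fc<gc = +-mono-≤-< (f≤g zero) (∑-mono-< (f≤g ∘ suc) c fc<gc)

indicator : Bool → ℕ
indicator b = if b then 1 else 0

indicator-mono-≤ : ∀ b c → (T b → T c) → indicator b ≤ indicator c
indicator-mono-≤ false c     _   = z≤n
indicator-mono-≤ true  true  _   = ≤-refl
indicator-mono-≤ true  false b⇒c = ⊥-elim (b⇒c tt)

indicator-mono-< : ∀ b c → ¬ T b → T c → indicator b < indicator c
indicator-mono-< false true  _  _ = s≤s z≤n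
indicator-mono-< true  _     ¬b _ = ⊥-elim (¬b tt)

count : (Fin n → Bool) → ℕ
count p = ∑ (indicator ∘ p)

count-mono-≤ : {p q : Fin n → Bool} → (∀ a → T (p a) → T (q a)) → count p ≤ count q
count-mono-≤ {p = p} {q} p⇒q = ∑-mono-≤ (λ a → indicator-mono-≤ (p a) (q a) (p⇒q a))

count-mono-< : {p q : Fin n → Bool} → (∀ a → T (p a) → T (q a)) →
               ∀ c → ¬ T (p c) → T (q c) → count p < count q
count-mono-< {p = p} {q} p⇒q c ¬pc qc =
  ∑-mono-< (λ a → indicator-mono-≤ (p a) (q a) (p⇒q a)) c (indicator-mono-< (p c) (q c) ¬pc qc)

aboveᵇ : Ordering m → Fin m → Fin m → Bool
aboveᵇ o a b = lookup (lookup (rel o) a) b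

-- The property fields of an ordering are irrelevant; decidability of T recovers them.
≻-asym : (o : Ordering m) → ∀ {a b} → a ≻[ o ] b → ¬ b ≻[ o ] a
≻-asym record { asym = asym } ab ba = Irrelevant.⊥-elim (asym _ _ ab ba)

≻-irrefl : (o : Ordering m) → ∀ a → ¬ a ≻[ o ] a
≻-irrefl o a aa = ≻-asym o aa aa

≻-trans : (o : Ordering m) → ∀ {a b c} → a ≻[ o ] b → b ≻[ o ] c → a ≻[ o ] c
≻-trans record { trans = trans } ab bc = recompute (T? _) (trans _ _ _ ab bc)

≻-complete : (o : Ordering m) → ∀ {a b} → a ≢ b → a ≻[ o ] b ⊎ b ≻[ o ] a
≻-complete record { complete = complete } a≢b = recompute (T? _ ⊎-dec T? _) (complete _ _ a≢b)

T-injective : ∀ {b c} → (T b → T c) → (T c → T b) → b ≡ c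
T-injective {false} {false} _   _   = refl
T-injective {true}  {true}  _   _   = refl
T-injective {true}  {false} b⇒c _   = ⊥-elim (b⇒c tt)
T-injective {false} {true}  _   c⇒b = ⊥-elim (c⇒b tt)

lookup-extensionality : {A : Set} {xs ys : Vec A n} → (∀ a → lookup xs a ≡ lookup ys a) → xs ≡ ys
lookup-extensionality {xs = xs} {ys} eq =
  trans (sym (tabulate∘lookup xs)) (trans (tabulate-cong eq) (tabulate∘lookup ys))

Ordering-≡ : {o o' : Ordering m} → rel o ≡ rel o' → o ≡ o'
Ordering-≡ refl = refl

≻-⊆⇒≡ : {o o' : Ordering m} → (∀ {a b} → a ≻[ o ] b → a ≻[ o' ] b) → o ≡ o'
≻-⊆⇒≡ {o = o} {o'} o⊆o' =
  Ordering-≡ (lookup-extensionality λ a → lookup-extensionality λ b → T-injective o⊆o' (o'⊆o a b))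
  where
  o'⊆o : ∀ a b → a ≻[ o' ] b → a ≻[ o ] b
  o'⊆o a b ab with a ≟ b
  ... | yes refl = ⊥-elim (≻-irrefl o' a ab)
  ... | no a≢b with ≻-complete o a≢b
  ...   | inj₁ ab′ = ab′
  ...   | inj₂ ba  = ⊥-elim (≻-asym o' ab (o⊆o' ba))

module _ (x y : Fin m) where

  swapFin-x : swapFin x y x ≡ y
  swapFin-x with x ≟ x
  ... | yes _  = refl
  ... | no x≢x = ⊥-elim (x≢x refl)

  swapFin-y : swapFin x y y ≡ x
  swapFin-y with y ≟ x
  ... | yes y≡x = y≡x
  ... | no _ with y ≟ y
  ...   | yes _  = refl
  ...   | no y≢y = ⊥-elim (y≢y refl)

  swapFin-other : ∀ {c} → c ≢ x → c ≢ y → swapFin x y c ≡ c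
  swapFin-other {c} c≢x c≢y with c ≟ x
  ... | yes c≡x = ⊥-elim (c≢x c≡x)
  ... | no _ with c ≟ y
  ...   | yes c≡y = ⊥-elim (c≢y c≡y)
  ...   | no _    = refl

  swapFin-involutive : ∀ c → swapFin x y (swapFin x y c) ≡ c
  swapFin-involutive c with c ≟ x
  ... | yes refl = swapFin-y
  ... | no c≢x with c ≟ y
  ...   | yes refl = swapFin-x
  ...   | no c≢y   = swapFin-other c≢x c≢y

  swapFin-injective : ∀ {a b} → swapFin x y a ≡ swapFin x y b → a ≡ b
  swapFin-injective {a} {b} eq = begin
    a                            ≡⟨ swapFin-involutive a ⟨
    swapFin x y (swapFin x y a)  ≡⟨ cong (swapFin x y) eq ⟩
    swapFin x y (swapFin x y b)  ≡⟨ swapFin-involutive b ⟩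
    b                            ∎
    where open ≡-Reasoning

  swapFin-respects : {A : Set} (f : Fin m → A) → f x ≡ f y → ∀ c → f (swapFin x y c) ≡ f c
  swapFin-respects f fx≡fy c with c ≟ x
  ... | yes refl = sym fx≡fy
  ... | no _ with c ≟ y
  ...   | yes refl = fx≡fy
  ...   | no _     = refl

  lookup-swapRel : ∀ M a b →
                   lookup (lookup (swapRel x y M) a) b ≡ lookup (lookup M (swapFin x y a)) (swapFin x y b)
  lookup-swapRel M a b = trans (cong (λ row → lookup row b) (lookup∘tabulate _ a)) (lookup∘tabulate _ b)

swapOrdering : Fin m → Fin m → Ordering m → Ordering m
swapOrdering x y record { rel = r ; asym = asym ; trans = trans ; complete = complete } = record
  { rel      = swapRel x y r
  ; asym     = λ a b ab ba → asym (σ a) (σ b) (to a b ab) (to b a ba)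
  ; trans    = λ a b c ab bc → from a c (trans (σ a) (σ b) (σ c) (to a b ab) (to b c bc))
  ; complete = λ a b a≢b → map (from a b) (from b a)
                             (complete (σ a) (σ b) (a≢b ∘ swapFin-injective x y))
  }
  where
  σ = swapFin x y
  to : ∀ a b → T (lookup (lookup (swapRel x y r) a) b) → T (lookup (lookup r (σ a)) (σ b))
  to a b = subst T (lookup-swapRel x y r a b)
  from : ∀ a b → T (lookup (lookup r (σ a)) (σ b)) → T (lookup (lookup (swapRel x y r) a) b)
  from a b = subst T (sym (lookup-swapRel x y r a b))

aboveᵇ-swapOrdering : ∀ (x y : Fin m) o a b →
                      aboveᵇ (swapOrdering x y o) a b ≡ aboveᵇ o (swapFin x y a) (swapFin x y b)
aboveᵇ-swapOrdering x y o = lookup-swapRel x y (rel o)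

aboveᵇ-irrefl : (o : Ordering m) → ∀ a → aboveᵇ o a a ≡ false
aboveᵇ-irrefl o a = T-injective (≻-irrefl o a) λ ()

¬≻⇒≺ : (o : Ordering m) → ∀ {a b} → a ≢ b → ¬ a ≻[ o ] b → b ≻[ o ] a
¬≻⇒≺ o a≢b ¬ab with ≻-complete o a≢b
... | inj₁ ab = ⊥-elim (¬ab ab)
... | inj₂ ba = ba

module _ {x y : Fin m} (o : Ordering m) where

  swapOrdering-≻⁺ : ∀ {a b} → swapFin x y a ≻[ o ] swapFin x y b → a ≻[ swapOrdering x y o ] b
  swapOrdering-≻⁺ {a} {b} = subst T (sym (aboveᵇ-swapOrdering x y o a b))

  swapOrdering-≻⁻ : ∀ {a b} → a ≻[ swapOrdering x y o ] b → swapFin x y a ≻[ o ] swapFin x y b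
  swapOrdering-≻⁻ {a} {b} = subst T (aboveᵇ-swapOrdering x y o a b)

module _ (o : Ordering m) {x y : Fin m} (imm : ImmAbove o x y) where

  private
    σ : Fin m → Fin m
    σ = swapFin x y

    s : Ordering m
    s = swapOrdering x y o

  swapOrdering-immAbove : ImmAbove s y x
  swapOrdering-immAbove =
      swapOrdering-≻⁺ o (subst₂ (_≻[ o ]_) (sym (swapFin-y x y)) (sym (swapFin-x x y)) (proj₁ imm))
    , λ z (yz , zx) → proj₂ imm (σ z)
        ( subst (_≻[ o ] σ z) (swapFin-y x y) (swapOrdering-≻⁻ o yz)
        , subst (σ z ≻[ o ]_) (swapFin-x x y) (swapOrdering-≻⁻ o zx) )

  -- No alternative lies between x and y, so every other alternative compares with them alike.
  aboveᵇ-x≡y-row : ∀ {d} → d ≢ x → d ≢ y → aboveᵇ o x d ≡ aboveᵇ o y d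
  aboveᵇ-x≡y-row d≢x d≢y =
    T-injective (λ xd → ¬≻⇒≺ o d≢y (λ dy → proj₂ imm _ (xd , dy))) (≻-trans o (proj₁ imm))

  aboveᵇ-x≡y-col : ∀ {d} → d ≢ x → d ≢ y → aboveᵇ o d x ≡ aboveᵇ o d y
  aboveᵇ-x≡y-col d≢x d≢y =
    T-injective (λ dx → ≻-trans o dx (proj₁ imm))
                (λ dy → ¬≻⇒≺ o (d≢x ∘ sym) (λ xd → proj₂ imm _ (xd , dy)))

  aboveᵇ-swapOrdering-≢ : ∀ {a b} → ¬ (a ≡ x × b ≡ y) → ¬ (a ≡ y × b ≡ x) →
                          aboveᵇ s a b ≡ aboveᵇ o a b
  aboveᵇ-swapOrdering-≢ {a} {b} ¬xy ¬yx with (b ≟ x) ⊎-dec (b ≟ y) | (a ≟ x) ⊎-dec (a ≟ y)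
  ... | no b∉xy | _ = begin
    aboveᵇ s a b          ≡⟨ aboveᵇ-swapOrdering x y o a b ⟩
    aboveᵇ o (σ a) (σ b)  ≡⟨ cong (aboveᵇ o (σ a)) (swapFin-other x y b≢x b≢y) ⟩
    aboveᵇ o (σ a) b      ≡⟨ swapFin-respects x y (λ c → aboveᵇ o c b) (aboveᵇ-x≡y-row b≢x b≢y) a ⟩
    aboveᵇ o a b          ∎
    where
    open ≡-Reasoning
    b≢x = b∉xy ∘ inj₁
    b≢y = b∉xy ∘ inj₂
  ... | yes _ | no a∉xy = begin
    aboveᵇ s a b          ≡⟨ aboveᵇ-swapOrdering x y o a b ⟩
    aboveᵇ o (σ a) (σ b)  ≡⟨ cong (λ c → aboveᵇ o c (σ b)) (swapFin-other x y a≢x a≢y) ⟩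
    aboveᵇ o a (σ b)      ≡⟨ swapFin-respects x y (aboveᵇ o a) (aboveᵇ-x≡y-col a≢x a≢y) b ⟩
    aboveᵇ o a b          ∎
    where
    open ≡-Reasoning
    a≢x = a∉xy ∘ inj₁
    a≢y = a∉xy ∘ inj₂
  ... | yes (inj₁ refl) | yes (inj₁ refl) = trans (aboveᵇ-irrefl s x) (sym (aboveᵇ-irrefl o x))
  ... | yes (inj₂ refl) | yes (inj₂ refl) = trans (aboveᵇ-irrefl s y) (sym (aboveᵇ-irrefl o y))
  ... | yes (inj₁ refl) | yes (inj₂ refl) = ⊥-elim (¬yx (refl , refl))
  ... | yes (inj₂ refl) | yes (inj₁ refl) = ⊥-elim (¬xy (refl , refl))

xor-agree : ∀ {b c} → (T b → T c) → (T c → T b) → ¬ T (b xor c)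
xor-agree {false} {false} _   _   ()
xor-agree {true}  {true}  _   _   ()
xor-agree {true}  {false} b⇒c _   = λ _ → b⇒c tt
xor-agree {false} {true}  _   c⇒b = λ _ → c⇒b tt

xor-differ : ∀ {b c} → T b → ¬ T c → T (b xor c)
xor-differ {true} {false} _ _  = tt
xor-differ {true} {true}  _ ¬c = ¬c tt

distance : Ordering m → Ordering m → ℕ
distance o o' = ∑ λ a → count λ b → aboveᵇ o a b xor aboveᵇ o' a b

distance-swapOrdering-< : (o o' : Ordering m) → ∀ {x y} → ImmAbove o x y → y ≻[ o' ] x →
                          distance (swapOrdering x y o) o' < distance o o'
distance-swapOrdering-< o o' {x} {y} imm yx′ =
  ∑-mono-< (λ a → count-mono-≤ (disagreement-kept a)) x
    (count-mono-< (disagreement-kept x) y agree-at-xy (xor-differ (proj₁ imm) (≻-asym o' yx′)))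
  where
  s = swapOrdering x y o
  yx : y ≻[ s ] x
  yx = proj₁ (swapOrdering-immAbove o imm)
  agree-at-xy : ¬ T (aboveᵇ s x y xor aboveᵇ o' x y)
  agree-at-xy = xor-agree (⊥-elim ∘ ≻-asym s yx) (⊥-elim ∘ ≻-asym o' yx′)
  disagreement-kept : ∀ a b → T (aboveᵇ s a b xor aboveᵇ o' a b) → T (aboveᵇ o a b xor aboveᵇ o' a b)
  disagreement-kept a b with (a ≟ x) ×-dec (b ≟ y) | (a ≟ y) ×-dec (b ≟ x)
  ... | yes (refl , refl) | _                 = ⊥-elim ∘ agree-at-xy
  ... | no _              | yes (refl , refl) = ⊥-elim ∘ xor-agree (λ _ → yx′) (λ _ → yx)
  ... | no ¬xy            | no ¬yx            =
    subst (λ t → T (t xor aboveᵇ o' a b)) (aboveᵇ-swapOrdering-≢ o imm ¬xy ¬yx)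

AdjacentInversion : Ordering m → Ordering m → Set
AdjacentInversion {m} o o' = ∃[ x ] ∃[ y ] ImmAbove o x y × y ≻[ o' ] x

module _ (o : Ordering m) where

  isBetween : Fin m → Fin m → Fin m → Bool
  isBetween a b z = aboveᵇ o a z ∧ aboveᵇ o z b

  between : Fin m → Fin m → ℕ
  between a b = count (isBetween a b)

  isBetween-intro : ∀ a b z → a ≻[ o ] z → z ≻[ o ] b → T (isBetween a b z)
  isBetween-intro a b z az zb = Equivalence.from (T-∧ {aboveᵇ o a z}) (az , zb)

  isBetween-elim : ∀ a b z → T (isBetween a b z) → a ≻[ o ] z × z ≻[ o ] b
  isBetween-elim a b z = Equivalence.to (T-∧ {aboveᵇ o a z})

  between-<ʳ : ∀ {a z b} → a ≻[ o ] z → z ≻[ o ] b → between a z < between a b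
  between-<ʳ {a} {z} {b} az zb =
    count-mono-< shrink z (≻-irrefl o z ∘ proj₂ ∘ isBetween-elim a z z) (isBetween-intro a b z az zb)
    where
    shrink : ∀ w → T (isBetween a z w) → T (isBetween a b w)
    shrink w awz with isBetween-elim a z w awz
    ... | aw , wz = isBetween-intro a b w aw (≻-trans o wz zb)

  between-<ˡ : ∀ {a z b} → a ≻[ o ] z → z ≻[ o ] b → between z b < between a b
  between-<ˡ {a} {z} {b} az zb =
    count-mono-< shrink z (≻-irrefl o z ∘ proj₁ ∘ isBetween-elim z b z) (isBetween-intro a b z az zb)
    where
    shrink : ∀ w → T (isBetween z b w) → T (isBetween a b w)
    shrink w zwb with isBetween-elim z b w zwb
    ... | zw , wb = isBetween-intro a b w (≻-trans o az zw) wb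

  -- Any z strictly between a and b leaves (a, z) or (z, b) inverted in o', with fewer
  -- alternatives in between.
  inversion⇒adjacentInversion : ∀ o' {a b} → a ≻[ o ] b → ¬ a ≻[ o' ] b → AdjacentInversion o o'
  inversion⇒adjacentInversion o' {a} {b} = go a b (<-wellFounded (between a b))
    where
    go : ∀ a b → Acc _<_ (between a b) → a ≻[ o ] b → ¬ a ≻[ o' ] b → AdjacentInversion o o'
    go a b (acc rec) ab ¬ab′ with any? (T? ∘ isBetween a b)
    ... | no nothing-between =
      a , b , (ab , λ z (az , zb) → nothing-between (z , isBetween-intro a b z az zb))
        , ¬≻⇒≺ o' (λ { refl → ≻-irrefl o a ab }) ¬ab′
    ... | yes (z , azb) with isBetween-elim a b z azb | T? (aboveᵇ o' a z)
    ...   | az , zb | no ¬az′ = go a z (rec (between-<ʳ az zb)) az ¬az′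
    ...   | az , zb | yes az′ = go z b (rec (between-<ˡ az zb)) zb (¬ab′ ∘ ≻-trans o' az′)

adjacentInversion⊎≡ : (o o' : Ordering m) → AdjacentInversion o o' ⊎ o ≡ o'
adjacentInversion⊎≡ o o' with any? (λ a → any? (λ b → T? (aboveᵇ o a b) ×-dec ¬? (T? (aboveᵇ o' a b))))
... | yes (a , b , ab , ¬ab′) = inj₁ (inversion⇒adjacentInversion o o' ab ¬ab′)
... | no no-inversion =
  inj₂ (≻-⊆⇒≡ λ {a} {b} ab → decidable-stable (T? _) λ ¬ab′ → no-inversion (a , b , ab , ¬ab′))

AdjacentTransposition : Ordering m → Ordering m → Set
AdjacentTransposition {m} o o' = ∃[ x ] ∃[ y ] ImmAbove o x y × o' ≡ swapOrdering x y o

-- Bubble sort: undoing an adjacent inversion decreases the distance to the target.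
adjacentTranspositions-connected : (o o' : Ordering m) → Star AdjacentTransposition o o'
adjacentTranspositions-connected o o' = go o (<-wellFounded (distance o o'))
  where
  go : ∀ o → Acc _<_ (distance o o') → Star AdjacentTransposition o o'
  go o (acc rec) with adjacentInversion⊎≡ o o'
  ... | inj₂ refl = ε
  ... | inj₁ (x , y , imm , yx′) =
    (x , y , imm , refl) ◅ go _ (rec (distance-swapOrdering-< o o' imm yx′))

update-invariant⇒constant : {A B : Set} (F : Vec A n → B) → (∀ v k a → F (v [ k ]≔ a) ≡ F v) →
                            ∀ v w → F v ≡ F w
update-invariant⇒constant F invariant []      []      = refl
update-invariant⇒constant F invariant (a ∷ v) (b ∷ w) =
  trans (sym (invariant (a ∷ v) zero b))
        (update-invariant⇒constant (F ∘ (b ∷_)) (λ v k c → invariant (b ∷ v) (suc k) c) v w)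

module _ {G : SCC m n} {i : Fin n} (ineffective : Ineffective G i) (balanced : Balanced G) where

  G-update-ineffective : ∀ u o → G (u [ i ]≔ o) ≡ G u
  G-update-ineffective u o = ineffective (u [ i ]≔ o) u (λ k k≢i → lookup∘update′ k≢i u o)

  G-adjacentTransposition : ∀ {j} → j ≢ i → ∀ u {o'} → AdjacentTransposition (lookup u j) o' →
                            G (u [ j ]≔ o') ≡ G u
  G-adjacentTransposition {j} j≢i u (x , y , imm , refl) = begin
    G (u [ j ]≔ s)  ≡⟨ G-update-ineffective (u [ j ]≔ s) s′ ⟨
    G v             ≡⟨ balanced x y u₁ v j i transposition ⟩
    G u₁            ≡⟨ G-update-ineffective u s ⟩
    G u             ∎
    where
    open ≡-Reasoning
    s  = swapOrdering x y (lookup u j)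
    s′ = swapOrdering x y s
    u₁ = u [ i ]≔ s
    v  = (u [ j ]≔ s) [ i ]≔ s′
    u₁j : lookup u₁ j ≡ lookup u j
    u₁j = lookup∘update′ j≢i u s
    u₁i : lookup u₁ i ≡ s
    u₁i = lookup∘update i u s
    vj : lookup v j ≡ s
    vj = trans (lookup∘update′ j≢i (u [ j ]≔ s) s′) (lookup∘update j u s)
    transposition : TranspPair u₁ v x y j i
    transposition =
        subst (λ t → ImmAbove t x y) (sym u₁j) imm
      , subst (λ t → ImmAbove t y x) (sym u₁i) (swapOrdering-immAbove (lookup u j) imm)
      , trans (cong rel vj) (cong (swapRel x y ∘ rel) (sym u₁j))
      , trans (cong rel (lookup∘update i (u [ j ]≔ s) s′)) (cong (swapRel x y ∘ rel) (sym u₁i))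
      , λ k k≢j k≢i → begin
          lookup v k              ≡⟨ lookup∘update′ k≢i (u [ j ]≔ s) s′ ⟩
          lookup (u [ j ]≔ s) k   ≡⟨ lookup∘update′ k≢j u s ⟩
          lookup u k              ≡⟨ lookup∘update′ k≢i u s ⟨
          lookup u₁ k             ∎

  G-adjacentTranspositions : ∀ {j} → j ≢ i → ∀ u {o o'} → lookup u j ≡ o →
                             Star AdjacentTransposition o o' → G (u [ j ]≔ o') ≡ G u
  G-adjacentTranspositions {j} j≢i u refl ε = cong G ([]≔-lookup u j)
  G-adjacentTranspositions {j} j≢i u refl (_◅_ {j = o₁} {k = o'} step steps) = begin
    G (u [ j ]≔ o')               ≡⟨ cong G ([]≔-idempotent u j) ⟨
    G (u [ j ]≔ o₁ [ j ]≔ o')     ≡⟨ G-adjacentTranspositions j≢i (u [ j ]≔ o₁)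
                                                              (lookup∘update j u o₁) steps ⟩
    G (u [ j ]≔ o₁)               ≡⟨ G-adjacentTransposition j≢i u step ⟩
    G u                           ∎
    where open ≡-Reasoning

  G-update : ∀ u j o → G (u [ j ]≔ o) ≡ G u
  G-update u j o with j ≟ i
  ... | yes refl = G-update-ineffective u o
  ... | no j≢i   = G-adjacentTranspositions j≢i u refl (adjacentTranspositions-connected (lookup u j) o)

theorem1 : (m n : ℕ) → 2 ≤ m → 2 ≤ n → (G : SCC m n) →
    (∀ (u : Profile m n) → Nonempty (G u)) →
    NonConstant G → (∃[ i ] Ineffective G i) → ¬ Balanced G
theorem1 m n _ _ G _ (u , u* , Gu≢Gu*) (i , ineffective) balanced =
  Gu≢Gu* (update-invariant⇒constant G (G-update ineffective balanced) u u*)
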